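{- Let $G=(V,E)$ be a finite, simple, connected graph that is AT-free and claw-free, and let $s$ be an admissible vertex of $G$. Then every BFS order of $G$ starting in $s$ is an AT-free order and a monotone dominating pair order of $G$.
   Context: A graph is claw-free if it has no induced $K_{1,3}$. An asteroidal triple is an independent set of three vertices such that for any two of them there is a path between them containing no neighbour of the third; $G$ is AT-free if it has none. A path $P$ avoids a vertex $v$ if $v$ has no neighbour on $P$. The domination betweenness $\mathcal{B}_D(G)$ is the set of triples $(x,y,z)$ of distinct vertices such that there is a chordless $x$-$y$-path avoiding $z$ and a chordless $y$-$z$-path avoiding $x$. A vertex $y$ is admissible if there are no $x,z$ with $(x,y,z)\in\mathcal{B}_D(G)$. An AT-free order is an ordering $\tau$ of $V$ such that for every $(x,y,z)\in\mathcal{B}_D(G)$ we have $y\prec_\tau x$ or $y\prec_\tau z$. Two vertices $a,b$ form a dominating pair of a graph $H$ if the vertex set of every $a$-$b$-path in $H$ is a dominating set of $H$. An ordering $\tau=(v_1,\ldots,v_n)$ is a monotone dominating pair order if for every $i$ the vertices $v_1,v_i$ form a dominating pair of $G[\{v_1,\ldots,v_i\}]$. A BFS order starting in $s$ is an ordering produced by a breadth-first search from $s$ with arbitrary tie-breaking. -}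

module Defs where

open import Data.Nat using (ℕ)
open import Data.Fin using (Fin)
open import Data.Bool using (Bool; true)
open import Data.Empty using (⊥)
open import Data.Maybe using (Maybe; just)
open import Data.List using (List; []; _∷_; _++_; [_]; head; last)
open import Data.List.Membership.Propositional using (_∈_; _∉_)
open import Data.List.Relation.Unary.All using (All)
open import Data.List.Relation.Unary.Any using (Any)
open import Data.List.Relation.Unary.Unique.Propositional using (Unique)
open import Data.List.Relation.Unary.Linked using (Linked)
open import Data.Product using (Σ; _×_; ∃; ∃-syntax)
open import Data.Sum using (_⊎_)
open import Data.Unit using (⊤)
open import Relation.Nullary using (¬_)
open import Relation.Binary.PropositionalEquality using (_≡_; _≢_)
open import Function.Bundles using (_⇔_)

record Graph (n : ℕ) : Set where
  field
    E      : Fin n → Fin n → Bool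
    sym    : ∀ u v → E u v ≡ E v u
    irrefl : ∀ v → E v v ≢ true

module _ {n : ℕ} (G : Graph n) where
  open Graph G

  V : Set
  V = Fin n

  Adj : V → V → Set
  Adj u v = E u v ≡ true

  IsPath : V → V → List V → Set
  IsPath x y P = Linked Adj P × Unique P × head P ≡ just x × last P ≡ just y

  Chordless : List V → Set
  Chordless []            = ⊤
  Chordless (v ∷ [])      = ⊤
  Chordless (v ∷ w ∷ vs)  = All (λ u → ¬ Adj v u) vs × Chordless (w ∷ vs)

  Avoids : List V → V → Set
  Avoids P z = All (λ u → ¬ Adj z u) P

  Connected : Set
  Connected = ∀ x y → ∃[ P ] IsPath x y P

  Claw : V → V → V → V → Set
  Claw c a b d = Adj c a × Adj c b × Adj c d
               × a ≢ b × a ≢ d × b ≢ d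
               × ¬ Adj a b × ¬ Adj a d × ¬ Adj b d

  ClawFree : Set
  ClawFree = ∀ c a b d → ¬ Claw c a b d

  AsteroidalTriple : V → V → V → Set
  AsteroidalTriple a b c =
    (a ≢ b × a ≢ c × b ≢ c) × (¬ Adj a b × ¬ Adj a c × ¬ Adj b c)
    × (∃[ P ] (IsPath a b P × Avoids P c))
    × (∃[ P ] (IsPath a c P × Avoids P b))
    × (∃[ P ] (IsPath b c P × Avoids P a))

  ATFree : Set
  ATFree = ∀ a b c → ¬ AsteroidalTriple a b c

  DomBetween : V → V → V → Set
  DomBetween x y z =
    (x ≢ y × y ≢ z × x ≢ z)
    × (∃[ P ] (IsPath x y P × Chordless P × Avoids P z))
    × (∃[ Q ] (IsPath y z Q × Chordless Q × Avoids Q x))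

  Admissible : V → Set
  Admissible y = ∀ x z → ¬ DomBetween x y z

  IsOrdering : List V → Set
  IsOrdering τ = Unique τ × (∀ v → v ∈ τ)

  Precedes : List V → V → V → Set
  Precedes τ x y = ∃[ l₁ ] ∃[ l₂ ] (τ ≡ l₁ ++ x ∷ l₂ × y ∈ l₂)

  IsATFreeOrder : List V → Set
  IsATFreeOrder τ = IsOrdering τ ×
    (∀ x y z → DomBetween x y z → Precedes τ y x ⊎ Precedes τ y z)

  DominatingPairIn : List V → V → V → Set
  DominatingPairIn S a b =
    ∀ P → IsPath a b P → All (_∈ S) P →
    ∀ w → w ∈ S → w ∈ P ⊎ Any (Adj w) P

  IsMonotoneDPOrder : List V → Set
  IsMonotoneDPOrder τ = IsOrdering τ ×
    (∀ S suf v₁ vᵢ → τ ≡ S ++ suf → head S ≡ just v₁ → last S ≡ just vᵢ →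
       DominatingPairIn S v₁ vᵢ)

  -- Breadth-first search with arbitrary tie-breaking, operationally.
  -- BFSRun out queue τ : from the state where `out` is the list of vertices
  -- discovered so far (in order) and `queue` the FIFO queue, the search can
  -- terminate producing the order τ.
  data BFSRun : List V → List V → List V → Set where
    done : ∀ out → BFSRun out [] out
    step : ∀ out u q N τ →
           Unique N →
           (∀ w → w ∈ N ⇔ (Adj u w × w ∉ out)) →
           BFSRun (out ++ N) (q ++ N) τ →
           BFSRun out (u ∷ q) τ

  IsBFSOrder : V → List V → Set
  IsBFSOrder s τ = BFSRun [ s ] [ s ] τ

-- τ layers the graph: s is alone on level 0, every other vertex has a parent
-- one level lower, neighbours differ in level by at most one, and levels never
-- decrease along τ.  Following parents gives a chordless descent v, …, s.
-- By claw-freeness a vertex a ≠ s has no two non-adjacent neighbours above it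
-- (add the parent of a), so a vertex y ≠ u, non-adjacent to u with ℓ u ≤ ℓ y,
-- sees the descent from u at most in s.
--   * AT-free order: if (x,y,z) ∈ B_D(G) with y after x and z, prune the walk
--     x ↘ s ↗ z to a chordless x-z-path; y sees none of it (seeing s would
--     give a claw at s), so x, y, z is an asteroidal triple.
--   * Dominating pairs: a vertex w of a prefix ending in b, neither on nor
--     next to an s-b-path, gives (w,s,b) ∈ B_D(G) via the descent from w.
module Submission where

open import Defs
open import Data.Nat using (ℕ; zero; suc; _≤_; _<_; z≤n; s≤s)
open import Data.Nat.Properties
  using (≤-trans; ≤-antisym; ≤-reflexive; <-trans; <-irrefl; ≤-<-trans; <-≤-trans;
         n≤1+n; suc-injective; n≤0⇒n≡0; n≢0⇒n>0)
open import Data.Fin.Properties using (_≟_)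
open import Data.Bool using (true)
import Data.Bool.Properties as Bool
open import Data.Maybe using (just)
import Data.Maybe.Relation.Binary.Connected as Maybe
open import Data.List using (List; []; _∷_; _++_; [_]; head; last)
open import Data.List.Properties using (++-assoc; ++-identityʳ; ∷-injectiveˡ)
open import Data.List.Membership.Propositional using (_∈_; _∉_; lose)
open import Data.List.Membership.Propositional.Properties using (∈-++⁺ˡ; ∈-++⁺ʳ; ∈-++⁻)
open import Data.List.Relation.Binary.Subset.Propositional using (_⊆_)
open import Data.List.Relation.Unary.All as All using (All; []; _∷_)
open import Data.List.Relation.Unary.All.Properties using (¬Any⇒All¬; anti-mono)
open import Data.List.Relation.Unary.Any using (Any; here; there; any?)
open import Data.List.Relation.Unary.AllPairs using (AllPairs; []; _∷_)
import Data.List.Relation.Unary.AllPairs.Properties as AllPairs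
open import Data.List.Relation.Unary.Unique.Propositional using (Unique)
import Data.List.Relation.Unary.Unique.Propositional.Properties as Unique
open import Data.List.Relation.Unary.Linked as Linked using (Linked; []; [-]; _∷_)
import Data.List.Relation.Unary.Linked.Properties as Linked
open import Data.Product using (_×_; _,_; ∃; ∃-syntax; proj₁; proj₂)
open import Data.Sum using (_⊎_; inj₁; inj₂)
open import Data.Empty using (⊥; ⊥-elim)
open import Data.Unit using (tt)
open import Function using (_∘_; id)
open import Function.Bundles using (_⇔_; Equivalence)
open import Relation.Nullary using (¬_; Dec; yes; no)
open import Relation.Binary.PropositionalEquality
  using (_≡_; _≢_; refl; sym; trans; cong; subst; subst₂)

module _ {A : Set} where

  ∈-head : ∀ {x} (xs : List A) → head xs ≡ just x → x ∈ xs
  ∈-head (y ∷ xs) refl = here refl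

  ∈-last : ∀ {x} (xs : List A) → last xs ≡ just x → x ∈ xs
  ∈-last (y ∷ []) refl = here refl
  ∈-last (y ∷ z ∷ xs) e = there (∈-last (z ∷ xs) e)

  last-snoc : ∀ (xs : List A) x → last (xs ++ [ x ]) ≡ just x
  last-snoc [] x = refl
  last-snoc (y ∷ []) x = refl
  last-snoc (y ∷ z ∷ xs) x = last-snoc (z ∷ xs) x

  linked-snoc : ∀ {R : A → A → Set} {xs a b} →
    Linked R xs → last xs ≡ just a → R a b → Linked R (xs ++ [ b ])
  linked-snoc {R} {b = b} lk e r =
    Linked.++⁺ lk (subst (λ m → Maybe.Connected R m (just b)) (sym e) (Maybe.just r)) [-]

  allPairs-suffix : ∀ {R : A → A → Set} (xs : List A) {ys} → AllPairs R (xs ++ ys) → AllPairs R ys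
  allPairs-suffix [] p = p
  allPairs-suffix (x ∷ xs) (_ ∷ p) = allPairs-suffix xs p

  before-last : ∀ (xs : List A) {w b} → w ∈ xs → last xs ≡ just b → w ≢ b →
    ∃[ l₁ ] ∃[ l₂ ] (xs ≡ l₁ ++ w ∷ l₂ × b ∈ l₂)
  before-last (x ∷ []) (here refl) refl w≢b = ⊥-elim (w≢b refl)
  before-last (x ∷ y ∷ xs) (here refl) e _ = [] , y ∷ xs , refl , ∈-last (y ∷ xs) e
  before-last (x ∷ y ∷ xs) (there m) e w≢b with before-last (y ∷ xs) m e w≢b
  ... | l₁ , l₂ , eq , b∈l₂ = x ∷ l₁ , l₂ , cong (x ∷_) eq , b∈l₂

module _ {n : ℕ} (G : Graph n) where

  adj? : ∀ u v → Dec (Adj G u v)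
  adj? u v = Graph.E G u v Bool.≟ true

  adj-sym : ∀ {u v} → Adj G u v → Adj G v u
  adj-sym {u} {v} a = trans (Graph.sym G v u) a

  adj-irrefl : ∀ {u v} → Adj G u v → u ≢ v
  adj-irrefl a refl = Graph.irrefl G _ a

  Independent : V G → V G → V G → Set
  Independent a b c = (a ≢ b × a ≢ c × b ≢ c) × (¬ Adj G a b × ¬ Adj G a c × ¬ Adj G b c)

  independent-swap : ∀ {a b c} → Independent a b c → Independent c b a
  independent-swap ((a≢b , a≢c , b≢c) , (¬ab , ¬ac , ¬bc)) =
    ((b≢c ∘ sym) , (a≢c ∘ sym) , (a≢b ∘ sym)) , ((¬bc ∘ adj-sym) , (¬ac ∘ adj-sym) , (¬ab ∘ adj-sym))

  -- The avoidance conditions in the definition of B_D(G) force independence.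
  between-independent : ∀ {x y z} → DomBetween G x y z → Independent x y z
  between-independent ((x≢y , y≢z , x≢z) , (P , (_ , _ , hP , lP) , _ , z-avoids)
                                         , (Q , (_ , _ , hQ , lQ) , _ , x-avoids)) =
    (x≢y , x≢z , y≢z) ,
    ( All.lookup x-avoids (∈-head Q hQ)
    , All.lookup x-avoids (∈-last Q lQ)
    , All.lookup z-avoids (∈-last P lP) ∘ adj-sym )

  precedes-total : ∀ xs {a b} → a ∈ xs → b ∈ xs → a ≢ b → Precedes G xs a b ⊎ Precedes G xs b a
  precedes-total (c ∷ xs) (here refl) (here refl) a≢b = ⊥-elim (a≢b refl)
  precedes-total (c ∷ xs) (here refl) (there b∈xs) _ = inj₁ ([] , xs , refl , b∈xs)
  precedes-total (c ∷ xs) (there a∈xs) (here refl) _ = inj₂ ([] , xs , refl , a∈xs)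
  precedes-total (c ∷ xs) (there a∈xs) (there b∈xs) a≢b with precedes-total xs a∈xs b∈xs a≢b
  ... | inj₁ (l₁ , l₂ , e , m) = inj₁ (c ∷ l₁ , l₂ , cong (c ∷_) e , m)
  ... | inj₂ (l₁ , l₂ , e , m) = inj₂ (c ∷ l₁ , l₂ , cong (c ∷_) e , m)

  precedes-last-of-prefix : ∀ {xs S suf w b} → xs ≡ S ++ suf → w ∈ S → last S ≡ just b → w ≢ b →
    Precedes G xs w b
  precedes-last-of-prefix {S = S} {suf} e w∈S lst w≢b with before-last S w∈S lst w≢b
  ... | l₁ , l₂ , refl , b∈l₂ =
    l₁ , l₂ ++ suf , trans e (++-assoc l₁ (_ ∷ l₂) suf) , ∈-++⁺ˡ b∈l₂

-- Chordless paths: every walk contains a chordless path between its ends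

module _ {n : ℕ} (G : Graph n) where

  Near : V G → V G → Set
  Near x v = v ≡ x ⊎ Adj G x v

  near? : ∀ x v → Dec (Near x v)
  near? x v with v ≟ x | adj? G x v
  ... | yes e | _     = yes (inj₁ e)
  ... | no _  | yes a = yes (inj₂ a)
  ... | no ne | no na = no λ { (inj₁ e) → ne e ; (inj₂ a) → na a }

  chordless-tail : ∀ {v vs} → Chordless G (v ∷ vs) → Chordless G vs
  chordless-tail {vs = []} _ = tt
  chordless-tail {vs = w ∷ vs} (_ , c) = c

  -- Prepending x to a chordless path C that x is near: cut C just before
  -- the last vertex near x.
  shortcut : ∀ {x y} C → Linked (Adj G) C → Unique C → Chordless G C → last C ≡ just y →
    Any (Near x) C → ∃[ P ] (IsPath G x y P × Chordless G P × P ⊆ x ∷ C)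
  shortcut {x} (c ∷ C) lk (c∉C ∷ uC) ch lst near with any? (near? x) C
  shortcut {x} (c ∷ C@(_ ∷ _)) lk (c∉C ∷ uC) ch lst near | yes nearC
    with shortcut C (Linked.tail lk) uC (chordless-tail ch) lst nearC
  ... | P , path , chP , P⊆x∷C = P , path , chP , widen ∘ P⊆x∷C
    where
    widen : x ∷ C ⊆ x ∷ c ∷ C
    widen (here e) = here e
    widen (there m) = there (there m)
  shortcut (c ∷ C) lk (c∉C ∷ uC) ch lst (here (inj₁ refl)) | no _ =
    c ∷ C , (lk , c∉C ∷ uC , refl , lst) , ch , there
  shortcut {x} (c ∷ C) lk (c∉C ∷ uC) ch lst (here (inj₂ x~c)) | no farC =
    x ∷ c ∷ C , (x~c ∷ lk , x∉c∷C ∷ c∉C ∷ uC , refl , lst) , (All.map (_∘ inj₂) far , ch) , id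
    where
    far : All (λ v → ¬ Near x v) C
    far = ¬Any⇒All¬ C farC
    x∉c∷C : All (x ≢_) (c ∷ C)
    x∉c∷C = adj-irrefl G x~c ∷ All.map (λ ¬near x≡v → ¬near (inj₁ (sym x≡v))) far
  shortcut (c ∷ C) lk (c∉C ∷ uC) ch lst (there nearC) | no farC = ⊥-elim (farC nearC)

  chordless-subpath : ∀ {x y} W → Linked (Adj G) (x ∷ W) → last (x ∷ W) ≡ just y →
    ∃[ P ] (IsPath G x y P × Chordless G P × P ⊆ x ∷ W)
  chordless-subpath {x} [] _ refl = [ x ] , ([-] , [] ∷ [] , refl , refl) , tt , id
  chordless-subpath {x} (r ∷ W) (x~r ∷ lk) lst with chordless-subpath W lk lst
  ... | C , (lkC , uC , hC , lC) , chC , C⊆W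
    with shortcut C lkC uC chC lC (lose (∈-head C hC) (inj₂ x~r))
  ... | P , path , chP , P⊆x∷C = P , path , chP , keep ∘ P⊆x∷C
    where
    keep : x ∷ C ⊆ x ∷ r ∷ W
    keep (here e) = here e
    keep (there m) = there (C⊆W m)

-- The layering induced by a BFS order

module BFS {n : ℕ} (G : Graph n) (s : V G) where
  open import Data.List.Membership.DecPropositional (_≟_ {n}) using (_∈?_)

  record Layering (τ : List (V G)) : Set where
    field
      ℓ          : V G → ℕ
      root-level : ℓ s ≡ 0
      parent     : ∀ v → v ≢ s → ∃[ u ] (Adj G u v × suc (ℓ u) ≡ ℓ v)
      adj-level  : ∀ {u v} → Adj G u v → ℓ v ≤ suc (ℓ u)
      monotone   : ∀ {a b} → Precedes G τ a b → ℓ a ≤ ℓ b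
      ordering   : IsOrdering G τ
      starts     : ∃[ t ] τ ≡ s ∷ t

  record Invariant (f : V G → ℕ) (out queue : List (V G)) : Set where
    field
      expanded : List (V G)
      split    : out ≡ expanded ++ queue
      starts   : ∃[ t ] out ≡ s ∷ t
      unique   : Unique out
      root     : f s ≡ 0
      sorted   : AllPairs (λ a b → f a ≤ f b) out
      gap      : ∀ {v h} → v ∈ out → h ∈ queue → f v ≤ suc (f h)
      parent   : ∀ {v} → v ∈ out → v ≢ s → ∃[ u ] (u ∈ out × Adj G u v × suc (f u) ≡ f v)
      closed   : ∀ {u v} → u ∈ expanded → Adj G u v → v ∈ out × f v ≤ suc (f u)

  initial : Invariant (λ _ → 0) [ s ] [ s ]
  initial = record
    { expanded = [] ; split = refl ; starts = [] , refl ; unique = [] ∷ [] ; root = refl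
    ; sorted = [] ∷ [] ; gap = λ _ _ → z≤n
    ; parent = λ { (here refl) s≢s → ⊥-elim (s≢s refl) } ; closed = λ () }

  relevel : (V G → ℕ) → ℕ → List (V G) → V G → ℕ
  relevel f k N w with w ∈? N
  ... | yes _ = k
  ... | no _  = f w

  sorted-cong : ∀ {f g : V G → ℕ} {xs} → All (λ w → g w ≡ f w) xs →
    AllPairs (λ a b → f a ≤ f b) xs → AllPairs (λ a b → g a ≤ g b) xs
  sorted-cong [] [] = []
  sorted-cong (e ∷ es) (le ∷ les) =
    All.zipWith (λ (e′ , le′) → subst₂ _≤_ (sym e) (sym e′) le′) (es , le) ∷ sorted-cong es les

  sorted-const : ∀ {g : V G → ℕ} {k xs} → All (λ w → g w ≡ k) xs → AllPairs (λ a b → g a ≤ g b) xs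
  sorted-const [] = []
  sorted-const (e ∷ es) = All.map (λ e′ → ≤-reflexive (trans e (sym e′))) es ∷ sorted-const es

  module Step {f out u queue N} (uniqueN : Unique N)
              (new : ∀ w → w ∈ N ⇔ (Adj G u w × w ∉ out))
              (I : Invariant f out (u ∷ queue)) where
    open Invariant I

    f′ : V G → ℕ
    f′ = relevel f (suc (f u)) N

    fresh : ∀ {w} → w ∈ N → w ∉ out
    fresh m = proj₂ (Equivalence.to (new _) m)

    old-level : ∀ {w} → w ∈ out → f′ w ≡ f w
    old-level {w} m with w ∈? N
    ... | yes m′ = ⊥-elim (fresh m′ m)
    ... | no _ = refl

    new-level : ∀ {w} → w ∈ N → f′ w ≡ suc (f u)
    new-level {w} m with w ∈? N
    ... | yes _ = refl
    ... | no m′ = ⊥-elim (m′ m)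

    queued : ∀ {w} → w ∈ u ∷ queue → w ∈ out
    queued m = subst (_ ∈_) (sym split) (∈-++⁺ʳ expanded m)

    u-least : ∀ {h} → h ∈ queue → f u ≤ f h
    u-least m with allPairs-suffix expanded (subst (AllPairs _) split sorted)
    ... | u≤ ∷ _ = All.lookup u≤ m

    below-next : ∀ {v} → v ∈ out ++ N → f′ v ≤ suc (f u)
    below-next m with ∈-++⁻ out m
    ... | inj₁ v∈out = subst (_≤ suc (f u)) (sym (old-level v∈out)) (gap v∈out (here refl))
    ... | inj₂ v∈N = ≤-reflexive (new-level v∈N)

    above-u : ∀ {h} → h ∈ queue ++ N → f u ≤ f′ h
    above-u m with ∈-++⁻ queue m
    ... | inj₁ h∈q = subst (f u ≤_) (sym (old-level (queued (there h∈q)))) (u-least h∈q)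
    ... | inj₂ h∈N = subst (f u ≤_) (sym (new-level h∈N)) (n≤1+n _)

    sorted′ : AllPairs (λ a b → f′ a ≤ f′ b) (out ++ N)
    sorted′ = AllPairs.++⁺ (sorted-cong {g = f′} (All.tabulate old-level) sorted)
                           (sorted-const {g = f′} (All.tabulate new-level))
                           (All.tabulate λ a∈out → All.tabulate λ b∈N →
                              subst₂ _≤_ (sym (old-level a∈out)) (sym (new-level b∈N)) (gap a∈out (here refl)))

    parent′ : ∀ {v} → v ∈ out ++ N → v ≢ s → ∃[ w ] (w ∈ out ++ N × Adj G w v × suc (f′ w) ≡ f′ v)
    parent′ m v≢s with ∈-++⁻ out m
    ... | inj₁ v∈out with parent v∈out v≢s
    ...   | w , w∈out , w~v , e =
            w , ∈-++⁺ˡ w∈out , w~v , trans (cong suc (old-level w∈out)) (trans e (sym (old-level v∈out)))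
    parent′ m v≢s | inj₂ v∈N =
      u , ∈-++⁺ˡ (queued (here refl)) , proj₁ (Equivalence.to (new _) v∈N) ,
      trans (cong suc (old-level (queued (here refl)))) (sym (new-level v∈N))

    closed′ : ∀ {x v} → x ∈ expanded ++ [ u ] → Adj G x v → v ∈ out ++ N × f′ v ≤ suc (f′ x)
    closed′ m x~v with ∈-++⁻ expanded m
    ... | inj₁ x∈exp with closed x∈exp x~v
    ...   | v∈out , le = ∈-++⁺ˡ v∈out ,
            subst₂ _≤_ (sym (old-level v∈out)) (cong suc (sym (old-level x∈out))) le
      where
      x∈out : _ ∈ out
      x∈out = subst (_ ∈_) (sym split) (∈-++⁺ˡ x∈exp)
    closed′ {v = v} m x~v | inj₂ (here refl) = v∈out′ ,
      subst (f′ v ≤_) (cong suc (sym (old-level (queued (here refl))))) (below-next v∈out′)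
      where
      v∈out′ : v ∈ out ++ N
      v∈out′ with v ∈? out
      ... | yes v∈out = ∈-++⁺ˡ v∈out
      ... | no v∉out = ∈-++⁺ʳ out (Equivalence.from (new v) (x~v , v∉out))

    invariant : Invariant f′ (out ++ N) (queue ++ N)
    invariant = record
      { expanded = expanded ++ [ u ]
      ; split = trans (cong (_++ N) split)
                      (trans (++-assoc expanded (u ∷ queue) N) (sym (++-assoc expanded [ u ] (queue ++ N))))
      ; starts = let (t , e) = starts in t ++ N , cong (_++ N) e
      ; unique = Unique.++⁺ unique uniqueN (λ (m , m′) → fresh m′ m)
      ; root = trans (old-level (subst (s ∈_) (sym (proj₂ starts)) (here refl))) root
      ; sorted = sorted′
      ; gap = λ v∈ h∈ → ≤-trans (below-next v∈) (s≤s (above-u h∈))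
      ; parent = parent′
      ; closed = closed′
      }

  run : ∀ {f out queue τ} → BFSRun G out queue τ → Invariant f out queue → ∃[ g ] Invariant g τ []
  run (done _) I = _ , I
  run (step _ _ _ _ _ uniqueN new r) I = run r (Step.invariant uniqueN new I)

  bfs-layering : ∀ {τ} → Connected G → IsBFSOrder G s τ → Layering τ
  bfs-layering {τ} connected bfs with run bfs initial
  ... | g , I = record
    { ℓ = g ; root-level = root
    ; parent = λ v v≢s → let (u , _ , u~v , e) = parent (cover v) v≢s in u , u~v , e
    ; adj-level = λ {u} u~v → proj₂ (closed (fully-expanded (cover u)) u~v)
    ; monotone = monotone
    ; ordering = unique , cover
    ; starts = starts
    }
    where
    open Invariant I
    fully-expanded : ∀ {v} → v ∈ τ → v ∈ expanded
    fully-expanded = subst (_ ∈_) (sym (trans (sym (++-identityʳ expanded)) (sym split)))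
    reach : ∀ {x} W → Linked (Adj G) (x ∷ W) → x ∈ τ → All (_∈ τ) (x ∷ W)
    reach [] _ x∈τ = x∈τ ∷ []
    reach (y ∷ W) (x~y ∷ lk) x∈τ = x∈τ ∷ reach W lk (proj₁ (closed (fully-expanded x∈τ) x~y))
    cover : ∀ v → v ∈ τ
    cover v with connected s v
    ... | (_ ∷ W) , lk , _ , refl , lst =
      All.lookup (reach W lk (subst (s ∈_) (sym (proj₂ starts)) (here refl))) (∈-last (s ∷ W) lst)
    monotone : ∀ {a b} → Precedes G τ a b → g a ≤ g b
    monotone (l₁ , l₂ , e , b∈l₂) with allPairs-suffix l₁ (subst (AllPairs _) e sorted)
    ... | a≤ ∷ _ = All.lookup a≤ b∈l₂

-- Descents to the root and what claw-freeness says about them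

module Layered {n : ℕ} {G : Graph n} {s : V G} {τ : List (V G)} (L : BFS.Layering G s τ) where
  open BFS.Layering L

  level-zero : ∀ {v} → ℓ v ≡ 0 → v ≡ s
  level-zero {v} e with v ≟ s
  ... | yes v≡s = v≡s
  ... | no v≢s with parent v v≢s
  ...   | _ , _ , e′ with trans e′ e
  ...     | ()

  level-one : ∀ {v} → ℓ v ≡ 1 → Adj G s v
  level-one {v} e with v ≟ s
  ... | yes refl with trans (sym root-level) e
  ...   | ()
  level-one {v} e | no v≢s with parent v v≢s
  ...   | u , u~v , e′ with level-zero (suc-injective (trans e′ e))
  ...     | refl = u~v

  level-≢ : ∀ {u v} → ℓ u < ℓ v → u ≢ v
  level-≢ lt refl = <-irrefl refl lt

  level-gap : ∀ {u v} → suc (ℓ u) < ℓ v → ¬ Adj G u v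
  level-gap lt u~v = <-irrefl refl (<-≤-trans lt (adj-level u~v))

  data Descent : V G → List (V G) → Set where
    at-root : Descent s []
    down    : ∀ {u v D} → Adj G v u → suc (ℓ u) ≡ ℓ v → Descent u D → Descent v (u ∷ D)

  descent-exists : ∀ v → ∃ (Descent v)
  descent-exists v = go (ℓ v) v refl
    where
    go : ∀ k v → ℓ v ≡ k → ∃ (Descent v)
    go zero v e with level-zero e
    ... | refl = [] , at-root
    go (suc k) v e with v ≟ s
    ... | yes refl with trans (sym root-level) e
    ...   | ()
    go (suc k) v e | no v≢s with parent v v≢s
    ...   | u , u~v , e′ with go k u (suc-injective (trans e′ e))
    ...     | D , d = u ∷ D , down (adj-sym G u~v) e′ d

  descent-below : ∀ {v D} → Descent v D → All (λ a → ℓ a < ℓ v) D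
  descent-below at-root = []
  descent-below (down _ e d) =
    ≤-reflexive e ∷ All.map (λ lt → <-trans lt (≤-reflexive e)) (descent-below d)

  -- A descent is a path from v to s (distinct vertices since levels differ)...
  descent-path : ∀ {v D} → Descent v D → IsPath G v s (v ∷ D)
  descent-path d = linked d , unique d , refl , ends d
    where
    linked : ∀ {v D} → Descent v D → Linked (Adj G) (v ∷ D)
    linked at-root = [-]
    linked (down v~u _ d) = v~u ∷ linked d
    unique : ∀ {v D} → Descent v D → Unique (v ∷ D)
    unique at-root = [] ∷ []
    unique d′@(down _ _ d) =
      All.map (λ lt v≡a → level-≢ lt (sym v≡a)) (descent-below d′) ∷ unique d
    ends : ∀ {v D} → Descent v D → last (v ∷ D) ≡ just s
    ends at-root = refl
    ends (down _ _ d) = ends d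

  -- ...and it is chordless, as non-consecutive vertices are two levels apart.
  descent-chordless : ∀ {v D} → Descent v D → Chordless G (v ∷ D)
  descent-chordless at-root = tt
  descent-chordless (down _ e d) =
    All.map (λ lt v~a → level-gap (<-≤-trans (s≤s lt) (≤-reflexive e)) (adj-sym G v~a)) (descent-below d)
    , descent-chordless d

  descent-top : ∀ {v D a} → Descent v D → a ∈ D → ℓ v ≤ suc (ℓ a) → Adj G a v
  descent-top (down v~u _ _) (here refl) _ = adj-sym G v~u
  descent-top (down _ e d) (there m) le =
    ⊥-elim (<-irrefl refl (≤-<-trans le (<-≤-trans (s≤s (All.lookup (descent-below d) m)) (≤-reflexive e))))

  walk-up : ∀ {x W z D} → Linked (Adj G) (x ∷ W) → last (x ∷ W) ≡ just s → Descent z D →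
    ∃[ W′ ] (Linked (Adj G) (x ∷ W′) × last (x ∷ W′) ≡ just z
             × (∀ {a} → a ∈ x ∷ W′ → a ∈ x ∷ W ⊎ a ∈ z ∷ D))
  walk-up lk lst at-root = _ , lk , lst , inj₁
  walk-up {x} {W} {z} lk lst (down {u} {D = D} z~u _ d) with walk-up lk lst d
  ... | W′ , lk′ , lst′ , origin =
    W′ ++ [ z ] , linked-snoc lk′ lst′ (adj-sym G z~u) , last-snoc (x ∷ W′) z , origin′
    where
    origin′ : ∀ {a} → a ∈ x ∷ W′ ++ [ z ] → a ∈ x ∷ W ⊎ a ∈ z ∷ u ∷ D
    origin′ m with ∈-++⁻ (x ∷ W′) m
    ... | inj₂ (here refl) = inj₂ (here refl)
    ... | inj₁ m′ with origin m′
    ...   | inj₁ old = inj₁ old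
    ...   | inj₂ on-u = inj₂ (there on-u)

  open import Data.List.Membership.DecPropositional (_≟_ {n}) using (_∈?_)

  cover : ∀ v → v ∈ τ
  cover = proj₂ ordering

  module _ (claw-free : ClawFree G) where

    -- A non-root vertex has no two distinct non-adjacent neighbours above it:
    -- with its parent they would form a claw.
    no-independent-children : ∀ {a x y} → a ≢ s → Adj G a x → Adj G a y →
      ℓ a < ℓ x → ℓ a < ℓ y → x ≢ y → ¬ Adj G x y → ⊥
    no-independent-children {a} {x} {y} a≢s a~x a~y ax ay x≢y ¬x~y with parent a a≢s
    ... | g , g~a , e =
      claw-free a x y g (a~x , a~y , adj-sym G g~a , x≢y , x≢g , y≢g , ¬x~y , ¬x~g , ¬y~g)
      where
      gx : suc (ℓ g) < ℓ x
      gx = subst (_< ℓ x) (sym e) ax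
      gy : suc (ℓ g) < ℓ y
      gy = subst (_< ℓ y) (sym e) ay
      x≢g : x ≢ g
      x≢g x≡g = level-≢ (≤-<-trans (n≤1+n _) gx) (sym x≡g)
      y≢g : y ≢ g
      y≢g y≡g = level-≢ (≤-<-trans (n≤1+n _) gy) (sym y≡g)
      ¬x~g : ¬ Adj G x g
      ¬x~g = level-gap gx ∘ adj-sym G
      ¬y~g : ¬ Adj G y g
      ¬y~g = level-gap gy ∘ adj-sym G

    only-root-sees-descent : ∀ {u D a y} → Descent u D → a ∈ D → Adj G y a →
      ℓ u ≤ ℓ y → u ≢ y → ¬ Adj G u y → a ≡ s × Adj G s u × ℓ y ≡ 1
    only-root-sees-descent {u} {a = a} {y} d m y~a uy u≢y ¬u~y = classify (a ≟ s)
      where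
      au : ℓ a < ℓ u
      au = All.lookup (descent-below d) m
      y≤a+1 : ℓ y ≤ suc (ℓ a)
      y≤a+1 = adj-level (adj-sym G y~a)
      a~u : Adj G a u
      a~u = descent-top d m (≤-trans uy y≤a+1)
      classify : Dec (a ≡ s) → a ≡ s × Adj G s u × ℓ y ≡ 1
      classify (no a≢s) =
        ⊥-elim (no-independent-children a≢s a~u (adj-sym G y~a) au (<-≤-trans au uy) u≢y ¬u~y)
      classify (yes a≡s) =
        a≡s , subst (λ b → Adj G b u) a≡s a~u ,
        ≤-antisym (subst (λ k → ℓ y ≤ suc k) a0 y≤a+1) (subst (λ k → suc k ≤ ℓ y) a0 (<-≤-trans au uy))
        where
        a0 : ℓ a ≡ 0
        a0 = trans (cong ℓ a≡s) root-level

    -- If u, y, o are independent and u, o lie no higher than y, then y sees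
    -- nothing of the descent from u: the root would be the only candidate,
    -- and then s, u, y, o form a claw.
    descent-hidden : ∀ {u D y o} → Descent u D → Independent G u y o → ℓ u ≤ ℓ y → ℓ o ≤ ℓ y →
      Avoids G (u ∷ D) y
    descent-hidden {u} {D} {y} {o} d ((u≢y , u≢o , y≢o) , (¬u~y , ¬u~o , ¬y~o)) uy oy =
      (¬u~y ∘ adj-sym G) ∷ All.tabulate hidden
      where
      hidden : ∀ {a} → a ∈ D → ¬ Adj G y a
      hidden m y~a with only-root-sees-descent d m y~a uy u≢y ¬u~y
      ... | refl , s~u , y1 =
        claw-free s u y o (s~u , adj-sym G y~a , s~o , u≢y , u≢o , y≢o , ¬u~y , ¬u~o , ¬y~o)
        where
        o≢s : o ≢ s
        o≢s refl = ¬u~o (adj-sym G s~u)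
        s~o : Adj G s o
        s~o = level-one (≤-antisym (subst (ℓ o ≤_) y1 oy) (n≢0⇒n>0 (o≢s ∘ level-zero)))

    no-late-middle : ATFree G → ∀ {x y z} → DomBetween G x y z → ℓ x ≤ ℓ y → ℓ z ≤ ℓ y → ⊥
    no-late-middle at-free {x} {y} {z} db@(_ , (P , pathP , _ , z-avoids) , (Q , pathQ , _ , x-avoids)) xy zy
      with descent-exists x | descent-exists z
    ... | Dx , dx | Dz , dz with descent-path dx
    ... | lkx , _ , _ , lstx with walk-up lkx lstx dz
    ... | W , lkW , lstW , origin with chordless-subpath G W lkW lstW
    ... | C , pathC , _ , C⊆W =
      at-free x y z (proj₁ ind , proj₂ ind , (P , pathP , z-avoids) , (C , pathC , y-avoids) , (Q , pathQ , x-avoids))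
      where
      ind : Independent G x y z
      ind = between-independent G db
      y-avoids : Avoids G C y
      y-avoids = All.tabulate (hidden ∘ origin ∘ C⊆W)
        where
        hidden : ∀ {a} → a ∈ x ∷ Dx ⊎ a ∈ z ∷ Dz → ¬ Adj G y a
        hidden (inj₁ m) = All.lookup (descent-hidden dx ind xy zy) m
        hidden (inj₂ m) = All.lookup (descent-hidden dz (independent-swap G ind) zy xy) m

    at-free-order : ATFree G → ∀ x y z → DomBetween G x y z → Precedes G τ y x ⊎ Precedes G τ y z
    at-free-order at-free x y z db@((x≢y , y≢z , _) , _) with precedes-total G τ (cover y) (cover x) (x≢y ∘ sym)
    ... | inj₁ y≺x = inj₁ y≺x
    ... | inj₂ x≺y with precedes-total G τ (cover y) (cover z) y≢z
    ...   | inj₁ y≺z = inj₂ y≺z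
    ...   | inj₂ z≺y = ⊥-elim (no-late-middle at-free db (monotone x≺y) (monotone z≺y))

    -- A vertex w neither on nor next to an s-b-path, with w not after b,
    -- witnesses (w, s, b) ∈ B_D(G): the descent from w avoids b.
    no-hidden-vertex : Admissible G s → ∀ {b P w} → IsPath G s b P → w ∉ P → Avoids G P w → ℓ w ≤ ℓ b → ⊥
    no-hidden-vertex admissible {b} {P@(_ ∷ rest)} {w} (lkP , _ , refl , lstP) w∉P w-avoids wb
      with descent-exists w | chordless-subpath G rest lkP lstP
    ... | D , d | C , pathC , chC , C⊆P =
      admissible w b ((w≢s , s≢b , w≢b)
                     , (w ∷ D , descent-path d , descent-chordless d , b-avoids)
                     , (C , pathC , chC , anti-mono C⊆P w-avoids))
      where
      b∈P : b ∈ P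
      b∈P = ∈-last P lstP
      w≢s : w ≢ s
      w≢s refl = w∉P (here refl)
      w≢b : w ≢ b
      w≢b refl = w∉P b∈P
      s≢b : s ≢ b
      s≢b refl = w≢s (level-zero (n≤0⇒n≡0 (subst (ℓ w ≤_) root-level wb)))
      ¬w~b : ¬ Adj G w b
      ¬w~b = All.lookup w-avoids b∈P
      b-avoids : Avoids G (w ∷ D) b
      b-avoids = (¬w~b ∘ adj-sym G) ∷ All.tabulate λ m b~a →
        All.lookup w-avoids (here refl) (adj-sym G (proj₁ (proj₂ (only-root-sees-descent d m b~a wb w≢b ¬w~b))))

    -- The dominating pair condition for every prefix of τ (which starts in s);
    -- the argument does not need the path to stay inside the prefix.
    monotone-dp-order : Admissible G s → ∀ S suf v₁ vᵢ → τ ≡ S ++ suf → head S ≡ just v₁ → last S ≡ just vᵢ →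
      DominatingPairIn G S v₁ vᵢ
    monotone-dp-order admissible (c ∷ S) suf .c b τ≡ refl lastS P pathP _ w w∈S
      with ∷-injectiveˡ (trans (sym τ≡) (proj₂ starts)) | w ∈? P | any? (adj? G w) P
    ... | _ | yes w∈P | _ = inj₁ w∈P
    ... | _ | no _ | yes seen = inj₂ seen
    ... | refl | no w∉P | no unseen =
      ⊥-elim (no-hidden-vertex admissible pathP w∉P (¬Any⇒All¬ P unseen) (monotone w≺b))
      where
      w≺b : Precedes G τ w b
      w≺b = precedes-last-of-prefix G τ≡ w∈S lastS (λ { refl → w∉P (∈-last P (proj₂ (proj₂ (proj₂ pathP)))) })

theorem5 : ∀ {n} (G : Graph n) → Connected G → ATFree G → ClawFree G →
    ∀ (s : V G) → Admissible G s →
    ∀ (τ : List (V G)) → IsBFSOrder G s τ →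
    IsATFreeOrder G τ × IsMonotoneDPOrder G τ
theorem5 G connected at-free claw-free s admissible τ bfs =
  (ordering , at-free-order claw-free at-free) , (ordering , monotone-dp-order claw-free admissible)
  where
  L : BFS.Layering G s τ
  L = BFS.bfs-layering G s connected bfs
  open BFS.Layering L using (ordering)
  open Layered L using (at-free-order; monotone-dp-order)
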